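{- Let $G$ be a directed multigraph on $[n+1]$ with edges $(i,j)$, $i<j$, and let $G^\star$ be obtained by adding a vertex $0$ and edges $(0,i)$ for $i=1,\ldots,n$. Identify $\mathbb{R}^n\times\mathbb{R}^{E(G)}$ with $\mathbb{R}^{E(G^\star)}$ by letting the $i$-th coordinate of $\mathbb{R}^n$ be the flow on the edge $(0,i)$. Then the Cayley embedding $\mathcal{C}\big(\mathcal{F}_G(e_1-e_{n+1}),\mathcal{F}_G(e_2-e_{n+1}),\ldots,\mathcal{F}_G(e_n-e_{n+1})\big)$ is the flow polytope $\mathcal{F}_{G^\star}(1,0,\ldots,0,-1)$ (netflow $1$ at vertex $0$, $-1$ at vertex $n+1$, $0$ elsewhere).
   Context: For a directed multigraph $H$ with edges from smaller to larger vertices and a zero-sum netflow vector $\mathbf b$, $\mathcal{F}_H(\mathbf b)$ is the set of nonnegative real edge flows with (outflow minus inflow) at each vertex equal to the corresponding entry of $\mathbf b$; $e_i$ denotes the $i$-th standard basis vector of $\mathbb{R}^{n+1}$ (vertex $i$). For polytopes $P_1,\ldots,P_n\subset\mathbb{R}^M$, the Cayley embedding $\mathcal{C}(P_1,\ldots,P_n)\subset\mathbb{R}^n\times\mathbb{R}^M$ is the convex hull of $\bigcup_i \{\mathsf e_i\}\times P_i$, where $\mathsf e_i$ is the $i$-th standard basis vector of $\mathbb{R}^n$. -}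

module Defs where

open import Data.Nat using (ℕ; zero; suc; _+_)
open import Data.Fin using (Fin; zero; suc; inject₁; fromℕ; splitAt; _<_; _≟_)
open import Data.Product using (_×_; _,_; proj₁; proj₂; Σ; ∃)
open import Data.Sum using (inj₁; inj₂)
open import Relation.Nullary using (¬_; yes; no)
open import Relation.Binary.PropositionalEquality using (_≡_)
open import Relation.Binary.Structures using (IsTotalOrder)
open import Algebra.Structures using (IsCommutativeRing)
open import Function.Bundles using (_⇔_)

-- Ordered fields (the stdlib has no real numbers; ℝ is an instance).

record OrderedField : Set₁ where
  infixl 6 _+F_
  infixl 7 _*F_
  field
    Carrier : Set
    _+F_ _*F_ : Carrier → Carrier → Carrier
    -F_ : Carrier → Carrier
    0F 1F : Carrier
    _≤F_ : Carrier → Carrier → Set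
    isCommutativeRing : IsCommutativeRing _≡_ _+F_ _*F_ -F_ 0F 1F
    0≢1 : ¬ (0F ≡ 1F)
    inverse : ∀ x → ¬ (x ≡ 0F) → Σ Carrier λ y → x *F y ≡ 1F
    isTotalOrder : IsTotalOrder _≡_ _≤F_
    +-mono-≤ : ∀ {x y} z → x ≤F y → (x +F z) ≤F (y +F z)
    *-nonneg : ∀ {x y} → 0F ≤F x → 0F ≤F y → 0F ≤F (x *F y)

module _ (K : OrderedField) where
  open OrderedField K

  Vec : ℕ → Set
  Vec N = Fin N → Carrier

  sumF : ∀ {N} → Vec N → Carrier
  sumF {zero} f = 0F
  sumF {suc N} f = f zero +F sumF (λ i → f (suc i))

  -- A directed multigraph on the vertex set Fin k with m edges, each edge
  -- given as (tail , head); the paper's convention: tail < head.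
  Edges : ℕ → ℕ → Set
  Edges k m = Fin m → Fin k × Fin k

  Increasing : ∀ {k m} → Edges k m → Set
  Increasing E = ∀ e → proj₁ (E e) < proj₂ (E e)

  ifEq : ∀ {k} → Fin k → Fin k → Carrier → Carrier
  ifEq i j x with i ≟ j
  ... | yes _ = x
  ... | no _ = 0F

  outflow inflow : ∀ {k m} → Edges k m → Vec m → Fin k → Carrier
  outflow E f v = sumF (λ e → ifEq (proj₁ (E e)) v (f e))
  inflow  E f v = sumF (λ e → ifEq (proj₂ (E e)) v (f e))

  FlowPolytope : ∀ {k m} → Edges k m → Vec k → Vec m → Set
  FlowPolytope E b f =
    (∀ e → 0F ≤F f e) × (∀ v → outflow E f v +F (-F inflow E f v) ≡ b v)

  ConvexHull : ∀ {N} → (Vec N → Set) → Vec N → Set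
  ConvexHull {N} S x =
    Σ ℕ λ r → Σ (Vec r) λ λs → Σ (Fin r → Vec N) λ p →
      (∀ j → S (p j)) × (∀ j → 0F ≤F λs j) × (sumF λs ≡ 1F)
      × (∀ c → x c ≡ sumF (λ j → λs j *F p j c))

  basis : ∀ {N} → Fin N → Vec N
  basis i j = ifEq i j 1F

  -- concatenation R^n × R^{E(G)} ≅ R^{E(G⋆)}
  _++V_ : ∀ {a b} → Vec a → Vec b → Vec (a + b)
  _++V_ {a} u w c with splitAt a c
  ... | inj₁ i = u i
  ... | inj₂ j = w j

  -- Cayley embedding C(P_1,…,P_n) ⊂ K^n × K^M, as a predicate on pairs.
  -- Points of K^n × K^M are encoded as Vec (n + M) via _++V_ (first n coordinates, then M coordinates).
  Cayley : ∀ {n M} → (Fin n → Vec M → Set) → Vec n → Vec M → Set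
  Cayley {n} {M} P x y =
    ConvexHull {n + M} (λ z → Σ (Fin n) λ i →
                          Σ (Vec M) λ q → P i q
                            × (∀ c → z c ≡ (basis i ++V q) c))
                       (x ++V y)

  -- Netflow e_i - e_{n+1} on vertices [n+1], encoded as Fin (suc n):
  -- paper vertex i ↦ index i-1; paper vertex i (1 ≤ i ≤ n) is inject₁ i
  -- for i : Fin n, and paper vertex n+1 is fromℕ n.
  netflowG : ∀ {n} → Fin n → Vec (suc n)
  netflowG {n} i v = ifEq (inject₁ i) v 1F +F ifEq (fromℕ n) v (-F 1F)

  -- G⋆: vertices 0,…,n+1 encoded as Fin (suc (suc n)) (paper vertex j ↦ j);
  -- vertex v of G (index v) becomes suc v.  Edges: the first n edges are
  -- (0,i), i = 1..n; then the edges of G, in order.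
  star : ∀ {n m} → Edges (suc n) m → Edges (suc (suc n)) (n + m)
  star {n} E e with splitAt n e
  ... | inj₁ i = (zero , suc (inject₁ i))
  ... | inj₂ d = (suc (proj₁ (E d)) , suc (proj₂ (E d)))

  netflowStar : ∀ {n} → Vec (suc (suc n))
  netflowStar {n} v = ifEq zero v 1F +F ifEq (fromℕ (suc n)) v (-F 1F)

-- A point of the Cayley embedding is a convex combination of points (e_s , q) with q a unit
-- flow on G from s to the sink n+1.  Read on G⋆, such a point is a unit flow from 0 to n+1, and
-- flow polytopes are convex, so the Cayley embedding lies in F_{G⋆}(1,0,…,0,-1).
-- Conversely, a flow (x , y) on G⋆ is a point x of the simplex together with a flow y on G with
-- supply x_s at s and demand 1 at the sink.  Since G is acyclic, y is a nonnegative combination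
-- of unit flows to the sink: erase the edges in increasing order of their tails (this keeps every
-- netflow away from the sink nonnegative) and glue each erased edge back onto unit flows leaving
-- its head.  Comparing netflows at s and at the sink, the unit flows from s carry total weight
-- x_s and all weights add up to 1, which is the required convex combination.

module Submission where

open import Algebra.Bundles using (CommutativeRing)
open import Algebra.Structures using (IsCommutativeRing)
open import Data.Empty using (⊥-elim)
open import Data.Fin.Base using (Fin; zero; suc; toℕ; inject₁; fromℕ; lower₁; splitAt; _↑ˡ_; _↑ʳ_)
open import Data.Fin.Properties
  using (_≟_; suc-injective; inject₁-injective; fromℕ≢inject₁; toℕ<n; toℕ≤pred[n]; inject₁-lower₁;
         splitAt-↑ˡ; splitAt-↑ʳ)
open import Data.Fin.Relation.Unary.Top using (view; ‵fromℕ; ‵inj₁)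
open import Data.Integer.Base as ℤ using (ℤ; +_; -[1+_]; _⊖_; _◃_; sign; ∣_∣)
import Data.Integer.Properties as ℤ
open import Data.List.Base using (List; []; _∷_; _++_; map; length; lookup; allFin)
open import Data.List.Membership.Propositional using (_∉_)
open import Data.List.Membership.Propositional.Properties using (∈-allFin; ∈-lookup)
open import Data.List.Relation.Unary.All as All using (All; []; _∷_)
open import Data.List.Relation.Unary.All.Properties using (++⁺; map⁺)
open import Data.List.Relation.Unary.Any using (here; there)
open import Data.Maybe.Base using (Maybe; just; nothing)
open import Data.Nat.Base as ℕ using (ℕ; zero; suc)
import Data.Nat.Properties as ℕ
open import Data.Product.Base using (Σ; ∃; _×_; _,_; proj₁; proj₂; map₂)
open import Data.Sign.Base as Sign using (Sign)
open import Data.Sum.Base using (_⊎_; inj₁; inj₂; [_,_]′)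
open import Function.Base using (_∘_)
open import Function.Bundles using (_⇔_; mk⇔)
open import Relation.Binary.PropositionalEquality as ≡ using (_≡_; _≢_; refl; sym; trans; cong; cong₂; subst; subst₂)
open import Relation.Binary.Structures using (IsTotalOrder)
open import Relation.Nullary.Decidable.Core using (yes; no; toSum)

open import Defs

-- Algebra.Solver.Ring needs coefficients whose equality it can decide; the integers map into
-- every commutative ring.
module CommutativeRingSolver {c ℓ} (R : CommutativeRing c ℓ) where

  open CommutativeRing R hiding (refl; sym; trans)
  open CommutativeRing R using () renaming (refl to ≈-refl; sym to ≈-sym; trans to ≈-trans)
  open import Algebra.Properties.Semiring.Mult.TCOptimised semiring using (1+×; ×-homo-+; ×1-homo-*)
    renaming (_×_ to _×ₙ_)
  open import Algebra.Properties.Ring ring using (-‿distribˡ-*; -‿distribʳ-*)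
  open import Algebra.Properties.AbelianGroup +-abelianGroup using (⁻¹-∙-comm; ⁻¹-involutive; ε⁻¹≈ε)
  open import Algebra.Properties.CommutativeSemigroup +-commutativeSemigroup using (x∙yz≈y∙xz)
  open import Algebra.Solver.Ring.AlmostCommutativeRing using (_-Raw-AlmostCommutative⟶_; fromCommutativeRing)
  open import Relation.Binary.Reasoning.Setoid setoid

  -- The optimised multiple has 1 ×ₙ x = x definitionally, so the constants of a solved
  -- equation are literally 0# and 1#.
  ⟦_⟧ : ℤ → Carrier
  ⟦ + n ⟧ = n ×ₙ 1#
  ⟦ -[1+ n ] ⟧ = - (suc n ×ₙ 1#)

  private
    1+a-[1+b]≈a-b : ∀ a b → (1# + a) - (1# + b) ≈ a - b
    1+a-[1+b]≈a-b a b = begin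
      (1# + a) - (1# + b)      ≈⟨ +-congˡ (⁻¹-∙-comm 1# b) ⟨
      (1# + a) + (- 1# - b)    ≈⟨ +-assoc 1# a _ ⟩
      1# + (a + (- 1# - b))    ≈⟨ +-congˡ (x∙yz≈y∙xz a (- 1#) (- b)) ⟩
      1# + (- 1# + (a - b))    ≈⟨ +-assoc 1# (- 1#) _ ⟨
      (1# - 1#) + (a - b)      ≈⟨ +-congʳ (-‿inverseʳ 1#) ⟩
      0# + (a - b)             ≈⟨ +-identityˡ _ ⟩
      a - b                    ∎

    signed : Sign → Carrier → Carrier
    signed Sign.+ x = x
    signed Sign.- x = - x

    ◃-homo : ∀ s n → ⟦ s ◃ n ⟧ ≈ signed s (n ×ₙ 1#)
    ◃-homo Sign.- zero = ≈-sym ε⁻¹≈ε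
    ◃-homo Sign.+ zero = ≈-refl
    ◃-homo Sign.- (suc n) = ≈-refl
    ◃-homo Sign.+ (suc n) = ≈-refl

    signed-* : ∀ s t x y → signed (s Sign.* t) (x * y) ≈ signed s x * signed t y
    signed-* Sign.+ Sign.+ x y = ≈-refl
    signed-* Sign.+ Sign.- x y = -‿distribʳ-* x y
    signed-* Sign.- Sign.+ x y = -‿distribˡ-* x y
    signed-* Sign.- Sign.- x y = begin
      x * y           ≈⟨ ⁻¹-involutive _ ⟨
      - - (x * y)     ≈⟨ -‿cong (-‿distribˡ-* x y) ⟩
      - (- x * y)     ≈⟨ -‿distribʳ-* _ _ ⟩
      - x * - y       ∎

    signed-cong : ∀ s {x y} → x ≈ y → signed s x ≈ signed s y
    signed-cong Sign.+ x≈y = x≈y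
    signed-cong Sign.- x≈y = -‿cong x≈y

    signed-abs : ∀ i → ⟦ i ⟧ ≈ signed (sign i) (∣ i ∣ ×ₙ 1#)
    signed-abs (+ n) = ≈-refl
    signed-abs -[1+ n ] = ≈-refl

  ⊖-homo : ∀ m n → ⟦ m ⊖ n ⟧ ≈ m ×ₙ 1# - n ×ₙ 1#
  ⊖-homo zero zero = ≈-sym (-‿inverseʳ 0#)
  ⊖-homo (suc m) zero = ≈-sym (≈-trans (+-congˡ ε⁻¹≈ε) (+-identityʳ _))
  ⊖-homo zero (suc n) = ≈-sym (+-identityˡ _)
  ⊖-homo (suc m) (suc n) = begin
    ⟦ suc m ⊖ suc n ⟧                ≡⟨ ≡.cong ⟦_⟧ (ℤ.[1+m]⊖[1+n]≡m⊖n m n) ⟩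
    ⟦ m ⊖ n ⟧                        ≈⟨ ⊖-homo m n ⟩
    m ×ₙ 1# - n ×ₙ 1#                ≈⟨ 1+a-[1+b]≈a-b _ _ ⟨
    (1# + m ×ₙ 1#) - (1# + n ×ₙ 1#)  ≈⟨ +-cong (1+× m 1#) (-‿cong (1+× n 1#)) ⟨
    suc m ×ₙ 1# - suc n ×ₙ 1#        ∎

  +-homo : ∀ i j → ⟦ i ℤ.+ j ⟧ ≈ ⟦ i ⟧ + ⟦ j ⟧
  +-homo -[1+ m ] -[1+ n ] = begin
    - (suc (suc (m ℕ.+ n)) ×ₙ 1#)    ≡⟨ ≡.cong (λ k → - (k ×ₙ 1#)) (ℕ.+-suc (suc m) n) ⟨
    - ((suc m ℕ.+ suc n) ×ₙ 1#)      ≈⟨ -‿cong (×-homo-+ 1# (suc m) (suc n)) ⟩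
    - (suc m ×ₙ 1# + suc n ×ₙ 1#)    ≈⟨ ⁻¹-∙-comm _ _ ⟨
    - (suc m ×ₙ 1#) - (suc n ×ₙ 1#)  ∎
  +-homo -[1+ m ] (+ n) = ≈-trans (⊖-homo n (suc m)) (+-comm _ _)
  +-homo (+ m) -[1+ n ] = ⊖-homo m (suc n)
  +-homo (+ m) (+ n) = ×-homo-+ 1# m n

  *-homo : ∀ i j → ⟦ i ℤ.* j ⟧ ≈ ⟦ i ⟧ * ⟦ j ⟧
  *-homo i j = begin
    ⟦ sign i Sign.* sign j ◃ ∣ i ∣ ℕ.* ∣ j ∣ ⟧
      ≈⟨ ◃-homo (sign i Sign.* sign j) (∣ i ∣ ℕ.* ∣ j ∣) ⟩
    signed (sign i Sign.* sign j) ((∣ i ∣ ℕ.* ∣ j ∣) ×ₙ 1#)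
      ≈⟨ signed-cong (sign i Sign.* sign j) (×1-homo-* ∣ i ∣ ∣ j ∣) ⟩
    signed (sign i Sign.* sign j) ((∣ i ∣ ×ₙ 1#) * (∣ j ∣ ×ₙ 1#))
      ≈⟨ signed-* (sign i) (sign j) _ _ ⟩
    signed (sign i) (∣ i ∣ ×ₙ 1#) * signed (sign j) (∣ j ∣ ×ₙ 1#)
      ≈⟨ *-cong (signed-abs i) (signed-abs j) ⟨
    ⟦ i ⟧ * ⟦ j ⟧ ∎

  -‿homo : ∀ i → ⟦ ℤ.- i ⟧ ≈ - ⟦ i ⟧
  -‿homo (+ zero) = ≈-sym ε⁻¹≈ε
  -‿homo (+ suc n) = ≈-refl
  -‿homo -[1+ n ] = ≈-sym (⁻¹-involutive _)

  homomorphism : ℤ.+-*-rawRing -Raw-AlmostCommutative⟶ fromCommutativeRing R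
  homomorphism = record
    { ⟦_⟧ = ⟦_⟧ ; +-homo = +-homo ; *-homo = *-homo ; -‿homo = -‿homo ; 0-homo = ≈-refl ; 1-homo = ≈-refl }

  ⟦⟧-weaklyDecidable : ∀ i j → Maybe (⟦ i ⟧ ≈ ⟦ j ⟧)
  ⟦⟧-weaklyDecidable i j with i ℤ.≟ j
  ... | yes i≡j = just (reflexive (≡.cong ⟦_⟧ i≡j))
  ... | no _ = nothing

  open import Algebra.Solver.Ring ℤ.+-*-rawRing (fromCommutativeRing R) homomorphism ⟦⟧-weaklyDecidable public
    using (solve; _:=_; _:+_; _:*_; _:-_; :-_; con)

fromℕ-or-inject₁ : ∀ {n} (v : Fin (suc n)) → v ≡ fromℕ n ⊎ ∃ λ i → v ≡ inject₁ i
fromℕ-or-inject₁ v with view v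
... | ‵fromℕ = inj₁ refl
... | ‵inj₁ {i = i} _ = inj₂ (i , refl)

module _ (K : OrderedField) where

  open OrderedField K
  open IsCommutativeRing isCommutativeRing using (+-identityˡ; +-identityʳ; *-identityʳ; -‿inverseʳ; zeroʳ; +-comm; *-comm)
  open IsTotalOrder isTotalOrder using ()
    renaming (refl to ≤-refl; trans to ≤-trans; antisym to ≤-antisym; total to ≤-total)

  commutativeRing : CommutativeRing _ _
  commutativeRing = record { isCommutativeRing = isCommutativeRing }

  open CommutativeRingSolver commutativeRing
    using (solve; _:=_; _:+_; _:*_; _:-_; :-_; con)

  0≤1 : 0F ≤F 1F
  0≤1 with ≤-total 0F 1F
  ... | inj₁ 0≤1 = 0≤1
  ... | inj₂ 1≤0 = subst (0F ≤F_) (solve 0 ((:- con (+ 1)) :* (:- con (+ 1)) := con (+ 1)) refl) (*-nonneg 0≤-1 0≤-1)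
    where
    0≤-1 : 0F ≤F (-F 1F)
    0≤-1 = subst₂ _≤F_ (-‿inverseʳ 1F) (+-identityˡ (-F 1F)) (+-mono-≤ (-F 1F) 1≤0)

  x≤y+x : ∀ {x y} → 0F ≤F y → x ≤F (y +F x)
  x≤y+x {x} {y} 0≤y = subst (_≤F (y +F x)) (+-identityˡ x) (+-mono-≤ x 0≤y)

  +-nonneg : ∀ {x y} → 0F ≤F x → 0F ≤F y → 0F ≤F (x +F y)
  +-nonneg 0≤x 0≤y = ≤-trans 0≤y (x≤y+x 0≤x)

  x≤y⇒0≤y-x : ∀ {x y} → x ≤F y → 0F ≤F (y +F -F x)
  x≤y⇒0≤y-x {x} {y} x≤y = subst (_≤F (y +F -F x)) (-‿inverseʳ x) (+-mono-≤ (-F x) x≤y)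

  a-b≡c⇒a≡c+b : ∀ {a b c} → a +F -F b ≡ c → a ≡ c +F b
  a-b≡c⇒a≡c+b {a} {b} a-b≡c = trans (solve 2 (λ a b → a := ((a :- b) :+ b)) refl a b) (cong (_+F b) a-b≡c)

  ifEq-refl : ∀ {k} (a : Fin k) x → ifEq K a a x ≡ x
  ifEq-refl a x with a ≟ a
  ... | yes _ = refl
  ... | no a≢a = ⊥-elim (a≢a refl)

  ifEq-≢ : ∀ {k} (a b : Fin k) x → a ≢ b → ifEq K a b x ≡ 0F
  ifEq-≢ a b x a≢b with a ≟ b
  ... | yes a≡b = ⊥-elim (a≢b a≡b)
  ... | no _ = refl

  ifEq-nonneg : ∀ {k} (a b : Fin k) {x} → 0F ≤F x → 0F ≤F ifEq K a b x
  ifEq-nonneg a b 0≤x with a ≟ b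
  ... | yes _ = 0≤x
  ... | no _ = ≤-refl

  ifEq-map : ∀ {k} (a b : Fin k) (f : Carrier → Carrier) → f 0F ≡ 0F → ∀ x → ifEq K a b (f x) ≡ f (ifEq K a b x)
  ifEq-map a b f f0≡0 x with a ≟ b
  ... | yes _ = refl
  ... | no _ = sym f0≡0

  ifEq-zero : ∀ {k} (a b : Fin k) → ifEq K a b 0F ≡ 0F
  ifEq-zero a b = ifEq-map a b (λ _ → 0F) refl 0F

  ifEq-+ : ∀ {k} (a b : Fin k) x y → ifEq K a b (x +F y) ≡ ifEq K a b x +F ifEq K a b y
  ifEq-+ a b x y with a ≟ b
  ... | yes _ = refl
  ... | no _ = sym (+-identityˡ 0F)

  ifEq-injective : ∀ {k l} (f : Fin k → Fin l) → (∀ {a b} → f a ≡ f b → a ≡ b) →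
                   ∀ a b x → ifEq K (f a) (f b) x ≡ ifEq K a b x
  ifEq-injective f f-injective a b x with a ≟ b | f a ≟ f b
  ... | yes _ | yes _ = refl
  ... | yes refl | no fa≢fb = ⊥-elim (fa≢fb refl)
  ... | no a≢b | yes fa≡fb = ⊥-elim (a≢b (f-injective fa≡fb))
  ... | no _ | no _ = refl

  ifEq-sym : ∀ {k} (a b : Fin k) x → ifEq K a b x ≡ ifEq K b a x
  ifEq-sym a b x with a ≟ b | b ≟ a
  ... | yes _ | yes _ = refl
  ... | yes refl | no b≢a = ⊥-elim (b≢a refl)
  ... | no a≢b | yes refl = ⊥-elim (a≢b refl)
  ... | no _ | no _ = refl

  ifEq-suc : ∀ {k} (a b : Fin k) x → ifEq K (suc a) (suc b) x ≡ ifEq K a b x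
  ifEq-suc = ifEq-injective suc suc-injective

  ifEq-suc-zero : ∀ {k} (a : Fin k) x → ifEq K (suc a) zero x ≡ 0F
  ifEq-suc-zero a x = ifEq-≢ (suc a) zero x λ ()

  ifEq-zero-suc : ∀ {k} (a : Fin k) x → ifEq K zero (suc a) x ≡ 0F
  ifEq-zero-suc a x = ifEq-≢ zero (suc a) x λ ()

  sumF-cong : ∀ {N} {f g : Vec K N} → (∀ i → f i ≡ g i) → sumF K f ≡ sumF K g
  sumF-cong {zero} f≡g = refl
  sumF-cong {suc N} f≡g = cong₂ _+F_ (f≡g zero) (sumF-cong (f≡g ∘ suc))

  sumF-zero : ∀ {N} {f : Vec K N} → (∀ i → f i ≡ 0F) → sumF K f ≡ 0F
  sumF-zero {zero} f≡0 = refl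
  sumF-zero {suc N} f≡0 = trans (cong₂ _+F_ (f≡0 zero) (sumF-zero (f≡0 ∘ suc))) (+-identityˡ 0F)

  sumF-+ : ∀ {N} (f g : Vec K N) → sumF K (λ i → f i +F g i) ≡ sumF K f +F sumF K g
  sumF-+ {zero} f g = sym (+-identityˡ 0F)
  sumF-+ {suc N} f g = trans (cong (f zero +F g zero +F_) (sumF-+ (f ∘ suc) (g ∘ suc)))
    (solve 4 (λ a b c d → ((a :+ b) :+ (c :+ d)) := ((a :+ c) :+ (b :+ d))) refl _ _ _ _)

  sumF-* : ∀ {N} c (f : Vec K N) → sumF K (λ i → c *F f i) ≡ c *F sumF K f
  sumF-* {zero} c f = sym (zeroʳ c)
  sumF-* {suc N} c f = trans (cong (c *F f zero +F_) (sumF-* c (f ∘ suc)))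
    (solve 3 (λ c a b → ((c :* a) :+ (c :* b)) := (c :* (a :+ b))) refl _ _ _)

  sumF-nonneg : ∀ {N} {f : Vec K N} → (∀ i → 0F ≤F f i) → 0F ≤F sumF K f
  sumF-nonneg {zero} 0≤f = ≤-refl
  sumF-nonneg {suc N} 0≤f = +-nonneg (0≤f zero) (sumF-nonneg (0≤f ∘ suc))

  sumF-ifEq : ∀ {N} (k : Fin N) (g : Vec K N) → sumF K (λ i → ifEq K k i (g i)) ≡ g k
  sumF-ifEq {suc N} zero g =
    trans (cong₂ _+F_ (ifEq-refl (zero {N}) (g zero)) (sumF-zero {N} (λ i → ifEq-zero-suc i (g (suc i))))) (+-identityʳ (g zero))
  sumF-ifEq {suc N} (suc k) g =
    trans (cong₂ _+F_ (ifEq-suc-zero k (g zero)) (trans (sumF-cong (λ i → ifEq-suc k i _)) (sumF-ifEq k (g ∘ suc))))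
          (+-identityˡ _)

  sumF-↑ : ∀ {a b} (f : Vec K (a ℕ.+ b)) → sumF K f ≡ sumF K (λ i → f (i ↑ˡ b)) +F sumF K (λ j → f (a ↑ʳ j))
  sumF-↑ {zero} f = sym (+-identityˡ _)
  sumF-↑ {suc a} {b} f = trans (cong (f zero +F_) (sumF-↑ {a} {b} (f ∘ suc)))
    (solve 3 (λ x y z → (x :+ (y :+ z)) := ((x :+ y) :+ z)) refl _ _ _)

  wsum : ∀ {A : Set} → (A → Carrier) → List (Carrier × A) → Carrier
  wsum h [] = 0F
  wsum h ((a , z) ∷ L) = a *F h z +F wsum h L

  ConicCombination : ∀ {A : Set} → (A → Set) → List (Carrier × A) → Set
  ConicCombination P = All (λ (a , z) → 0F ≤F a × P z)

  wsum-cong : ∀ {A : Set} {h g : A → Carrier} (L : List (Carrier × A)) → (∀ z → h z ≡ g z) → wsum h L ≡ wsum g L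
  wsum-cong [] h≡g = refl
  wsum-cong ((a , z) ∷ L) h≡g = cong₂ (λ u v → a *F u +F v) (h≡g z) (wsum-cong L h≡g)

  wsum-cong-on : ∀ {A : Set} {P : A → Set} {h g : A → Carrier} {L} → ConicCombination P L →
                 (∀ {z} → P z → h z ≡ g z) → wsum h L ≡ wsum g L
  wsum-cong-on [] h≡g = refl
  wsum-cong-on ((_ , Pz) ∷ conic) h≡g = cong₂ (λ u v → _ *F u +F v) (h≡g Pz) (wsum-cong-on conic h≡g)

  wsum-++ : ∀ {A : Set} (h : A → Carrier) L M → wsum h (L ++ M) ≡ wsum h L +F wsum h M
  wsum-++ h [] M = sym (+-identityˡ _)
  wsum-++ h ((a , z) ∷ L) M = trans (cong (a *F h z +F_) (wsum-++ h L M))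
    (solve 3 (λ x y w → (x :+ (y :+ w)) := ((x :+ y) :+ w)) refl _ _ _)

  wsum-map₂ : ∀ {A B : Set} (h : B → Carrier) (f : A → B) L → wsum h (map (map₂ f) L) ≡ wsum (h ∘ f) L
  wsum-map₂ h f [] = refl
  wsum-map₂ h f ((a , z) ∷ L) = cong (a *F h (f z) +F_) (wsum-map₂ h f L)

  wsum-+ : ∀ {A : Set} (h g : A → Carrier) L → wsum (λ z → h z +F g z) L ≡ wsum h L +F wsum g L
  wsum-+ h g [] = sym (+-identityˡ 0F)
  wsum-+ h g ((a , z) ∷ L) = trans (cong (a *F (h z +F g z) +F_) (wsum-+ h g L))
    (solve 5 (λ a x y u v → ((a :* (x :+ y)) :+ (u :+ v)) := (((a :* x) :+ u) :+ ((a :* y) :+ v))) refl _ _ _ _ _)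

  wsum-const : ∀ {A : Set} c (L : List (Carrier × A)) → wsum (λ _ → c) L ≡ wsum (λ _ → 1F) L *F c
  wsum-const c [] = solve 1 (λ c → con (+ 0) := (con (+ 0) :* c)) refl c
  wsum-const c ((a , z) ∷ L) = trans (cong (a *F c +F_) (wsum-const c L))
    (solve 3 (λ a c w → ((a :* c) :+ (w :* c)) := (((a :* con (+ 1)) :+ w) :* c)) refl _ _ _)

  sumF-lookup : ∀ {A : Set} (h : A → Carrier) L →
                sumF K (λ j → proj₁ (lookup L j) *F h (proj₂ (lookup L j))) ≡ wsum h L
  sumF-lookup h [] = refl
  sumF-lookup h ((a , z) ∷ L) = cong (a *F h z +F_) (sumF-lookup h L)

  record Split {A : Set} {k} (P : A → Set) (key : A → Fin k) (w : Fin k) (c : Carrier) (L : List (Carrier × A)) : Set where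
    field
      taken rest : List (Carrier × A)
      taken-conic : ConicCombination (λ z → P z × key z ≡ w) taken
      rest-conic : ConicCombination P rest
      taken-weight : wsum (λ _ → 1F) taken ≡ c
      partition : ∀ h → wsum h taken +F wsum h rest ≡ wsum h L

  split : ∀ {A : Set} {k} {P : A → Set} (key : A → Fin k) (w : Fin k) {c} L → ConicCombination P L →
          0F ≤F c → c ≤F wsum (λ z → basis K (key z) w) L → Split P key w c L
  split key w [] [] 0≤c c≤0 = record
    { taken = [] ; rest = [] ; taken-conic = [] ; rest-conic = []
    ; taken-weight = ≤-antisym 0≤c c≤0
    ; partition = λ _ → +-identityˡ 0F
    }
  split key w {c} ((a , z) ∷ L) ((0≤a , Pz) ∷ conic) 0≤c c≤mass with toSum (key z ≟ w)
  ... | inj₂ key≢w = record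
    { taken = taken
    ; rest = (a , z) ∷ rest
    ; taken-conic = taken-conic
    ; rest-conic = (0≤a , Pz) ∷ rest-conic
    ; taken-weight = taken-weight
    ; partition = λ h → trans (solve 3 (λ x y u → (x :+ (y :+ u)) := (y :+ (x :+ u))) refl _ _ _)
                              (cong (a *F h z +F_) (partition h))
    }
    where
    c≤mass′ : c ≤F wsum (λ z′ → basis K (key z′) w) L
    c≤mass′ = subst (c ≤F_)
                    (trans (cong (λ δ → a *F δ +F wsum (λ z′ → basis K (key z′) w) L) (ifEq-≢ (key z) w 1F key≢w))
                           (solve 2 (λ a u → ((a :* con (+ 0)) :+ u) := u) refl a _))
                    c≤mass
    open Split (split key w L conic 0≤c c≤mass′)
  ... | inj₁ refl with ≤-total c a
  ...   | inj₁ c≤a = record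
    { taken = (c , z) ∷ []
    ; rest = (a +F -F c , z) ∷ L
    ; taken-conic = (0≤c , Pz , refl) ∷ []
    ; rest-conic = (x≤y⇒0≤y-x c≤a , Pz) ∷ conic
    ; taken-weight = solve 1 (λ c → ((c :* con (+ 1)) :+ con (+ 0)) := c) refl c
    ; partition = λ h → solve 4 (λ a c x u → (((c :* x) :+ con (+ 0)) :+ (((a :- c) :* x) :+ u)) := ((a :* x) :+ u))
                                refl a c (h z) _
    }
  ...   | inj₂ a≤c = record
    { taken = (a , z) ∷ taken
    ; rest = rest
    ; taken-conic = (0≤a , Pz , refl) ∷ taken-conic
    ; rest-conic = rest-conic
    ; taken-weight = trans (cong (a *F 1F +F_) taken-weight) (solve 2 (λ a c → ((a :* con (+ 1)) :+ (c :- a)) := c) refl a c)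
    ; partition = λ h → trans (solve 3 (λ x y u → ((x :+ y) :+ u) := (x :+ (y :+ u))) refl _ _ _)
                              (cong (a *F h z +F_) (partition h))
    }
    where
    mass : Carrier
    mass = wsum (λ z′ → basis K (key z′) (key z)) L
    c-a≤mass : (c +F -F a) ≤F mass
    c-a≤mass = subst ((c +F -F a) ≤F_)
                     (trans (cong (λ δ → (a *F δ +F mass) +F -F a) (ifEq-refl (key z) 1F))
                            (solve 2 (λ a u → (((a :* con (+ 1)) :+ u) :- a) := u) refl a mass))
                     (+-mono-≤ (-F a) c≤mass)
    open Split (split key (key z) L conic (x≤y⇒0≤y-x a≤c) c-a≤mass)

  -- Netflow as a linear functional

  record Linear {M : ℕ} (φ : Vec K M → Carrier) : Set where
    field
      extensional : ∀ {f g} → (∀ e → f e ≡ g e) → φ f ≡ φ g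
      additive : ∀ f g → φ (λ e → f e +F g e) ≡ φ f +F φ g
      homogeneous : ∀ c f → φ (λ e → c *F f e) ≡ c *F φ f

    preserves-zero : φ (λ _ → 0F) ≡ 0F
    preserves-zero =
      trans (extensional (λ _ → sym (zeroʳ 0F)))
            (trans (homogeneous 0F (λ _ → 0F)) (solve 1 (λ x → (con (+ 0) :* x) := con (+ 0)) refl _))

    preserves-sumF : ∀ {N} (F : Fin N → Vec K M) → φ (λ e → sumF K (λ j → F j e)) ≡ sumF K (λ j → φ (F j))
    preserves-sumF {zero} F = preserves-zero
    preserves-sumF {suc N} F = trans (additive (F zero) _) (cong (φ (F zero) +F_) (preserves-sumF (F ∘ suc)))

    preserves-wsum : ∀ {A : Set} (p : A → Vec K M) L → φ (λ e → wsum (λ z → p z e) L) ≡ wsum (φ ∘ p) L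
    preserves-wsum p [] = preserves-zero
    preserves-wsum p ((a , z) ∷ L) =
      trans (additive (λ e → a *F p z e) _) (cong₂ _+F_ (homogeneous a (p z)) (preserves-wsum p L))

  sumF-ifEq-linear : ∀ {k M} (t : Fin M → Fin k) v → Linear (λ f → sumF K (λ e → ifEq K (t e) v (f e)))
  sumF-ifEq-linear t v = record
    { extensional = λ f≡g → sumF-cong (λ e → cong (ifEq K (t e) v) (f≡g e))
    ; additive = λ f g → trans (sumF-cong (λ e → ifEq-+ (t e) v (f e) (g e)))
        (sumF-+ (λ e → ifEq K (t e) v (f e)) (λ e → ifEq K (t e) v (g e)))
    ; homogeneous = λ c f → trans (sumF-cong (λ e → ifEq-map (t e) v (c *F_) (zeroʳ c) (f e)))
        (sumF-* c (λ e → ifEq K (t e) v (f e)))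
    }

  Linear-difference : ∀ {M} {φ ψ : Vec K M → Carrier} → Linear φ → Linear ψ → Linear (λ f → φ f +F -F ψ f)
  Linear-difference φ-linear ψ-linear = record
    { extensional = λ f≡g → cong₂ (λ a b → a +F -F b) (Φ.extensional f≡g) (Ψ.extensional f≡g)
    ; additive = λ f g → trans (cong₂ (λ a b → a +F -F b) (Φ.additive f g) (Ψ.additive f g))
        (solve 4 (λ a b c d → ((a :+ b) :- (c :+ d)) := ((a :- c) :+ (b :- d))) refl _ _ _ _)
    ; homogeneous = λ c f → trans (cong₂ (λ a b → a +F -F b) (Φ.homogeneous c f) (Ψ.homogeneous c f))
        (solve 3 (λ c a b → ((c :* a) :- (c :* b)) := (c :* (a :- b))) refl _ _ _)
    }
    where
    module Φ = Linear φ-linear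
    module Ψ = Linear ψ-linear

  netflow : ∀ {k M} → Edges K k M → Vec K M → Fin k → Carrier
  netflow E f v = outflow K E f v +F -F inflow K E f v

  netflow-linear : ∀ {k M} (E : Edges K k M) v → Linear (λ f → netflow E f v)
  netflow-linear E v = Linear-difference (sumF-ifEq-linear (proj₁ ∘ E) v) (sumF-ifEq-linear (proj₂ ∘ E) v)

  sumF-ifEq-basis : ∀ {k M} (t : Fin M → Fin k) e v → sumF K (λ e′ → ifEq K (t e′) v (basis K e e′)) ≡ ifEq K (t e) v 1F
  sumF-ifEq-basis t e v =
    trans (sumF-cong (λ e′ → ifEq-map (t e′) v (ifEq K e e′) (ifEq-zero e e′) 1F))
          (sumF-ifEq e (λ e′ → ifEq K (t e′) v 1F))

  netflow-basis : ∀ {k M} (E : Edges K k M) e v →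
                  netflow E (basis K e) v ≡ ifEq K (proj₁ (E e)) v 1F +F -F ifEq K (proj₂ (E e)) v 1F
  netflow-basis E e v = cong₂ (λ a b → a +F -F b) (sumF-ifEq-basis (proj₁ ∘ E) e v) (sumF-ifEq-basis (proj₂ ∘ E) e v)

  netflow-nonneg-without-inflow : ∀ {k M} (E : Edges K k M) {f} v → (∀ e → 0F ≤F f e) →
                                  (∀ e → proj₂ (E e) ≡ v → f e ≡ 0F) → 0F ≤F netflow E f v
  netflow-nonneg-without-inflow E {f} v 0≤f inflow-vanishes =
    subst (0F ≤F_) (sym (trans (cong (λ i → outflow K E f v +F -F i) no-inflow) (solve 1 (λ o → (o :- con (+ 0)) := o) refl _)))
          (sumF-nonneg (λ e → ifEq-nonneg (proj₁ (E e)) v (0≤f e)))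
    where
    no-inflow : inflow K E f v ≡ 0F
    no-inflow = sumF-zero vanishes
      where
      vanishes : ∀ e → ifEq K (proj₂ (E e)) v (f e) ≡ 0F
      vanishes e with toSum (proj₂ (E e) ≟ v)
      ... | inj₁ head≡v = trans (cong (ifEq K (proj₂ (E e)) v) (inflow-vanishes e head≡v)) (ifEq-zero (proj₂ (E e)) v)
      ... | inj₂ head≢v = ifEq-≢ (proj₂ (E e)) v (f e) head≢v

  FlowPolytope-cong : ∀ {k M} (E : Edges K k M) b {f g : Vec K M} → (∀ e → f e ≡ g e) →
                      FlowPolytope K E b g → FlowPolytope K E b f
  FlowPolytope-cong E b f≡g (0≤g , conservation) =
    (λ e → subst (0F ≤F_) (sym (f≡g e)) (0≤g e)) ,
    (λ v → trans (Linear.extensional (netflow-linear E v) f≡g) (conservation v))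

  FlowPolytope-convex : ∀ {k M} (E : Edges K k M) b {f} → ConvexHull K (FlowPolytope K E b) f → FlowPolytope K E b f
  FlowPolytope-convex E b {f} (r , ws , p , p∈ , 0≤ws , Σws≡1 , f≡) = nonneg , conservation
    where
    open ≡.≡-Reasoning
    nonneg : ∀ e → 0F ≤F f e
    nonneg e = subst (0F ≤F_) (sym (f≡ e)) (sumF-nonneg (λ j → *-nonneg (0≤ws j) (proj₁ (p∈ j) e)))
    conservation : ∀ v → netflow E f v ≡ b v
    conservation v = begin
      netflow E f v                                    ≡⟨ extensional f≡ ⟩
      netflow E (λ e → sumF K (λ j → ws j *F p j e)) v ≡⟨ preserves-sumF (λ j e → ws j *F p j e) ⟩
      sumF K (λ j → netflow E (λ e → ws j *F p j e) v) ≡⟨ sumF-cong (λ j → homogeneous (ws j) (p j)) ⟩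
      sumF K (λ j → ws j *F netflow E (p j) v)         ≡⟨ sumF-cong (λ j → cong (ws j *F_) (proj₂ (p∈ j) v)) ⟩
      sumF K (λ j → ws j *F b v)                       ≡⟨ sumF-cong (λ j → *-comm (ws j) (b v)) ⟩
      sumF K (λ j → b v *F ws j)                       ≡⟨ sumF-* (b v) ws ⟩
      b v *F sumF K ws                                 ≡⟨ cong (b v *F_) Σws≡1 ⟩
      b v *F 1F                                        ≡⟨ *-identityʳ (b v) ⟩
      b v                                              ∎
      where open Linear (netflow-linear E v)

  ConvexHull-mono : ∀ {N} {S T : Vec K N → Set} → (∀ z → S z → T z) → ∀ {x} → ConvexHull K S x → ConvexHull K T x
  ConvexHull-mono S⊆T (r , ws , p , p∈ , rest) = r , ws , p , (λ j → S⊆T (p j) (p∈ j)) , rest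

  ConvexHull-fromList : ∀ {N} {A : Set} {S : Vec K N → Set} (point : A → Vec K N) L →
    ConicCombination (S ∘ point) L → wsum (λ _ → 1F) L ≡ 1F →
    ∀ {x} → (∀ c → x c ≡ wsum (λ z → point z c) L) → ConvexHull K S x
  ConvexHull-fromList point L conic total x≡ =
    length L , proj₁ ∘ lookup L , point ∘ proj₂ ∘ lookup L ,
    (λ j → proj₂ (All.lookup conic (∈-lookup j))) ,
    (λ j → proj₁ (All.lookup conic (∈-lookup j))) ,
    trans (sumF-cong {f = proj₁ ∘ lookup L} (λ j → sym (*-identityʳ _))) (trans (sumF-lookup (λ _ → 1F) L) total) ,
    (λ c → trans (x≡ c) (sym (sumF-lookup (λ z → point z c) L)))

  ++V-↑ˡ : ∀ {a b} (u : Vec K a) (w : Vec K b) i → _++V_ K u w (i ↑ˡ b) ≡ u i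
  ++V-↑ˡ {a} {b} u w i rewrite splitAt-↑ˡ a i b = refl

  ++V-↑ʳ : ∀ {a b} (u : Vec K a) (w : Vec K b) j → _++V_ K u w (a ↑ʳ j) ≡ w j
  ++V-↑ʳ {a} {b} u w j rewrite splitAt-↑ʳ a b j = refl

  ++V-nonneg : ∀ {a b} {u : Vec K a} {w : Vec K b} → (∀ i → 0F ≤F u i) → (∀ j → 0F ≤F w j) →
               ∀ c → 0F ≤F _++V_ K u w c
  ++V-nonneg {a} 0≤u 0≤w c with splitAt a c
  ... | inj₁ i = 0≤u i
  ... | inj₂ j = 0≤w j

  ++V-cong : ∀ {a b} {u u′ : Vec K a} {w w′ : Vec K b} → (∀ i → u i ≡ u′ i) → (∀ j → w j ≡ w′ j) →
             ∀ c → _++V_ K u w c ≡ _++V_ K u′ w′ c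
  ++V-cong {a} u≡ w≡ c with splitAt a c
  ... | inj₁ i = u≡ i
  ... | inj₂ j = w≡ j

  wsum-++V : ∀ {a b} {A : Set} (u : A → Vec K a) (w : A → Vec K b) L c →
             wsum (λ z → _++V_ K (u z) (w z) c) L ≡ _++V_ K (λ i → wsum (λ z → u z i) L) (λ j → wsum (λ z → w z j) L) c
  wsum-++V {a} u w L c with splitAt a c
  ... | inj₁ i = refl
  ... | inj₂ j = refl

  netflowG-inject₁ : ∀ {n} (s i : Fin n) → netflowG K s (inject₁ i) ≡ basis K s i
  netflowG-inject₁ s i =
    trans (cong₂ _+F_ (ifEq-injective inject₁ inject₁-injective s i 1F) (ifEq-≢ (fromℕ _) (inject₁ i) (-F 1F) fromℕ≢inject₁))
          (+-identityʳ _)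

  netflowG-fromℕ : ∀ {n} (s : Fin n) → netflowG K s (fromℕ n) ≡ -F 1F
  netflowG-fromℕ {n} s =
    trans (cong₂ _+F_ (ifEq-≢ (inject₁ s) (fromℕ n) 1F (fromℕ≢inject₁ ∘ sym)) (ifEq-refl (fromℕ n) (-F 1F))) (+-identityˡ _)

  netflowStar-zero : ∀ {n} → netflowStar K {n} zero ≡ 1F
  netflowStar-zero {n} = trans (cong₂ _+F_ (ifEq-refl (zero {suc n}) 1F) (ifEq-suc-zero (fromℕ n) (-F 1F))) (+-identityʳ 1F)

  netflowStar-suc : ∀ {n} (v : Fin (suc n)) → netflowStar K (suc v) ≡ ifEq K (fromℕ n) v (-F 1F)
  netflowStar-suc {n} v =
    trans (cong₂ _+F_ (ifEq-zero-suc v 1F) (ifEq-suc (fromℕ n) v (-F 1F))) (+-identityˡ _)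

  -- The star graph

  module _ {n m : ℕ} (G : Edges K (suc n) m) where

    tail head : Fin m → Fin (suc n)
    tail = proj₁ ∘ G
    head = proj₂ ∘ G

    star-↑ˡ : ∀ i → star K G (i ↑ˡ m) ≡ (zero , suc (inject₁ i))
    star-↑ˡ i rewrite splitAt-↑ˡ n i m = refl

    star-↑ʳ : ∀ e → star K G (n ↑ʳ e) ≡ (suc (tail e) , suc (head e))
    star-↑ʳ e rewrite splitAt-↑ʳ n m e = refl

    sumF-star : (φ : Fin (suc (suc n)) × Fin (suc (suc n)) → Carrier → Carrier) (x : Vec K n) (y : Vec K m) →
      sumF K (λ c → φ (star K G c) (_++V_ K x y c)) ≡
      sumF K (λ i → φ (zero , suc (inject₁ i)) (x i)) +F sumF K (λ e → φ (suc (tail e) , suc (head e)) (y e))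
    sumF-star φ x y = trans (sumF-↑ {n} {m} (λ c → φ (star K G c) (_++V_ K x y c)))
      (cong₂ _+F_ (sumF-cong (λ i → cong₂ φ (star-↑ˡ i) (++V-↑ˡ x y i)))
                  (sumF-cong (λ e → cong₂ φ (star-↑ʳ e) (++V-↑ʳ x y e))))

    netflow-star-zero : ∀ x y → netflow (star K G) (_++V_ K x y) zero ≡ sumF K x
    netflow-star-zero x y = begin
      netflow (star K G) (_++V_ K x y) zero
        ≡⟨ cong₂ (λ a b → a +F -F b) (sumF-star (λ p → ifEq K (proj₁ p) zero) x y)
                                     (sumF-star (λ p → ifEq K (proj₂ p) zero) x y) ⟩
      (sumF K (λ i → ifEq K (zero {suc n}) zero (x i)) +F sumF K (λ e → ifEq K (suc (tail e)) zero (y e)))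
        +F -F (sumF K (λ i → ifEq K (suc (inject₁ i)) zero (x i)) +F sumF K (λ e → ifEq K (suc (head e)) zero (y e)))
        ≡⟨ cong₂ (λ a b → a +F -F b)
                 (cong₂ _+F_ (sumF-cong (λ i → ifEq-refl (zero {suc n}) (x i))) (sumF-zero (λ e → ifEq-suc-zero (tail e) (y e))))
                 (cong₂ _+F_ (sumF-zero (λ i → ifEq-suc-zero (inject₁ i) (x i)))
                             (sumF-zero (λ e → ifEq-suc-zero (head e) (y e)))) ⟩
      (sumF K x +F 0F) +F -F (0F +F 0F)
        ≡⟨ solve 1 (λ s → ((s :+ con (+ 0)) :- (con (+ 0) :+ con (+ 0))) := s) refl _ ⟩
      sumF K x ∎
      where open ≡.≡-Reasoning

    netflow-star-suc : ∀ x y v → netflow (star K G) (_++V_ K x y) (suc v) ≡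
                                 netflow G y v +F -F sumF K (λ i → ifEq K (inject₁ i) v (x i))
    netflow-star-suc x y v = begin
      netflow (star K G) (_++V_ K x y) (suc v)
        ≡⟨ cong₂ (λ a b → a +F -F b) (sumF-star (λ p → ifEq K (proj₁ p) (suc v)) x y)
                                     (sumF-star (λ p → ifEq K (proj₂ p) (suc v)) x y) ⟩
      (sumF K (λ i → ifEq K zero (suc v) (x i)) +F sumF K (λ e → ifEq K (suc (tail e)) (suc v) (y e)))
        +F -F (sumF K (λ i → ifEq K (suc (inject₁ i)) (suc v) (x i)) +F sumF K (λ e → ifEq K (suc (head e)) (suc v) (y e)))
        ≡⟨ cong₂ (λ a b → a +F -F b)
                 (cong₂ _+F_ (sumF-zero (λ i → ifEq-zero-suc v (x i))) (sumF-cong (λ e → ifEq-suc (tail e) v (y e))))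
                 (cong₂ _+F_ (sumF-cong (λ i → ifEq-suc (inject₁ i) v (x i))) (sumF-cong (λ e → ifEq-suc (head e) v (y e)))) ⟩
      (0F +F outflow K G y v) +F -F (sumF K (λ i → ifEq K (inject₁ i) v (x i)) +F inflow K G y v)
        ≡⟨ solve 3 (λ o s i → ((con (+ 0) :+ o) :- (s :+ i)) := ((o :- i) :- s)) refl _ _ _ ⟩
      netflow G y v +F -F sumF K (λ i → ifEq K (inject₁ i) v (x i)) ∎
      where open ≡.≡-Reasoning

    sumF-ifEq-inject₁ : ∀ (x : Vec K n) k → sumF K (λ i → ifEq K (inject₁ i) (inject₁ k) (x i)) ≡ x k
    sumF-ifEq-inject₁ x k =
      trans (sumF-cong (λ i → trans (ifEq-injective inject₁ inject₁-injective i k (x i)) (ifEq-sym i k (x i)))) (sumF-ifEq k x)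

    sumF-ifEq-fromℕ : ∀ (x : Vec K n) → sumF K (λ i → ifEq K (inject₁ i) (fromℕ n) (x i)) ≡ 0F
    sumF-ifEq-fromℕ x = sumF-zero (λ i → ifEq-≢ (inject₁ i) (fromℕ n) (x i) (fromℕ≢inject₁ ∘ sym))

    StarFlow : Vec K n → Vec K m → Set
    StarFlow x y = FlowPolytope K (star K G) (netflowStar K) (_++V_ K x y)

    record SimplexFlow (x : Vec K n) (y : Vec K m) : Set where
      field
        supply-nonneg : ∀ i → 0F ≤F x i
        supply-total : sumF K x ≡ 1F
        flow-nonneg : ∀ e → 0F ≤F y e
        netflow-inject₁ : ∀ i → netflow G y (inject₁ i) ≡ x i
        netflow-fromℕ : netflow G y (fromℕ n) ≡ -F 1F

    StarFlow⇒SimplexFlow : ∀ {x y} → StarFlow x y → SimplexFlow x y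
    StarFlow⇒SimplexFlow {x} {y} (0≤x++y , conservation) = record
      { supply-nonneg = λ i → subst (0F ≤F_) (++V-↑ˡ x y i) (0≤x++y (i ↑ˡ m))
      ; supply-total = trans (sym (netflow-star-zero x y)) (trans (conservation zero) (netflowStar-zero {n}))
      ; flow-nonneg = λ e → subst (0F ≤F_) (++V-↑ʳ x y e) (0≤x++y (n ↑ʳ e))
      ; netflow-inject₁ = λ i → trans (netflow-y (inject₁ i))
          (trans (cong₂ _+F_ (ifEq-≢ (fromℕ n) (inject₁ i) (-F 1F) fromℕ≢inject₁) (sumF-ifEq-inject₁ x i))
                 (+-identityˡ (x i)))
      ; netflow-fromℕ = trans (netflow-y (fromℕ n))
          (trans (cong₂ _+F_ (ifEq-refl (fromℕ n) (-F 1F)) (sumF-ifEq-fromℕ x)) (+-identityʳ (-F 1F)))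
      }
      where
      netflow-y : ∀ v → netflow G y v ≡ ifEq K (fromℕ n) v (-F 1F) +F sumF K (λ i → ifEq K (inject₁ i) v (x i))
      netflow-y v = a-b≡c⇒a≡c+b (trans (sym (netflow-star-suc x y v)) (trans (conservation (suc v)) (netflowStar-suc v)))

    SimplexFlow⇒StarFlow : ∀ {x y} → SimplexFlow x y → StarFlow x y
    SimplexFlow⇒StarFlow {x} {y} flow = ++V-nonneg supply-nonneg flow-nonneg , conservation
      where
      open SimplexFlow flow
      conservation : ∀ v → netflow (star K G) (_++V_ K x y) v ≡ netflowStar K v
      conservation zero = trans (netflow-star-zero x y) (trans supply-total (sym (netflowStar-zero {n})))
      conservation (suc v) with fromℕ-or-inject₁ v
      ... | inj₁ refl = begin
        netflow (star K G) (_++V_ K x y) (suc (fromℕ n))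
          ≡⟨ netflow-star-suc x y (fromℕ n) ⟩
        netflow G y (fromℕ n) +F -F sumF K (λ i → ifEq K (inject₁ i) (fromℕ n) (x i))
          ≡⟨ cong₂ (λ a b → a +F -F b) netflow-fromℕ (sumF-ifEq-fromℕ x) ⟩
        -F 1F +F -F 0F
          ≡⟨ solve 1 (λ a → (a :- con (+ 0)) := a) refl (-F 1F) ⟩
        -F 1F
          ≡⟨ trans (netflowStar-suc (fromℕ n)) (ifEq-refl (fromℕ n) (-F 1F)) ⟨
        netflowStar K (suc (fromℕ n)) ∎
        where open ≡.≡-Reasoning
      ... | inj₂ (i , refl) = begin
        netflow (star K G) (_++V_ K x y) (suc (inject₁ i))
          ≡⟨ netflow-star-suc x y (inject₁ i) ⟩
        netflow G y (inject₁ i) +F -F sumF K (λ k → ifEq K (inject₁ k) (inject₁ i) (x k))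
          ≡⟨ cong₂ (λ a b → a +F -F b) (netflow-inject₁ i) (sumF-ifEq-inject₁ x i) ⟩
        x i +F -F x i
          ≡⟨ -‿inverseʳ (x i) ⟩
        0F
          ≡⟨ trans (netflowStar-suc (inject₁ i)) (ifEq-≢ (fromℕ n) (inject₁ i) (-F 1F) fromℕ≢inject₁) ⟨
        netflowStar K (suc (inject₁ i)) ∎
        where open ≡.≡-Reasoning

    UnitFlow : Fin n × Vec K m → Set
    UnitFlow (s , q) = FlowPolytope K G (netflowG K s) q

    UnitFlow⇒SimplexFlow : ∀ {s q} → UnitFlow (s , q) → SimplexFlow (basis K s) q
    UnitFlow⇒SimplexFlow {s} {q} (0≤q , conservation) = record
      { supply-nonneg = λ i → ifEq-nonneg s i 0≤1
      ; supply-total = sumF-ifEq s (λ _ → 1F)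
      ; flow-nonneg = 0≤q
      ; netflow-inject₁ = λ i → trans (conservation (inject₁ i)) (netflowG-inject₁ s i)
      ; netflow-fromℕ = trans (conservation (fromℕ n)) (netflowG-fromℕ s)
      }

    CayleyGenerator : Vec K (n ℕ.+ m) → Set
    CayleyGenerator z = Σ (Fin n) λ s → Σ (Vec K m) λ q → UnitFlow (s , q) × (∀ c → z c ≡ _++V_ K (basis K s) q c)

    Cayley⇒StarFlow : ∀ {x y} → Cayley K (λ s q → UnitFlow (s , q)) x y → StarFlow x y
    Cayley⇒StarFlow hull = FlowPolytope-convex (star K G) (netflowStar K) (ConvexHull-mono generator∈star hull)
      where
      generator∈star : ∀ z → CayleyGenerator z → FlowPolytope K (star K G) (netflowStar K) z
      generator∈star z (s , q , q∈ , z≡) =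
        FlowPolytope-cong (star K G) (netflowStar K) z≡ (SimplexFlow⇒StarFlow (UnitFlow⇒SimplexFlow {s} {q} q∈))

    -- Decomposition into unit flows

    superposition : List (Carrier × (Fin n × Vec K m)) → Vec K m
    superposition L e = wsum (λ (_ , q) → q e) L

    Decomposition : Vec K m → Set
    Decomposition y = Σ (List (Carrier × (Fin n × Vec K m))) λ L →
                        ConicCombination UnitFlow L × (∀ e → y e ≡ superposition L e)

    netflow-superposition : ∀ {L} → ConicCombination UnitFlow L → ∀ v →
                            netflow G (superposition L) v ≡ wsum (λ (s , _) → netflowG K s v) L
    netflow-superposition {L} conic v = trans (preserves-wsum proj₂ L) (wsum-cong-on conic (λ q∈ → proj₂ q∈ v))
      where open Linear (netflow-linear G v)

    source-mass : ∀ {L} → ConicCombination UnitFlow L → ∀ w →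
                  wsum (λ z → basis K (proj₁ z) w) L ≡ netflow G (superposition L) (inject₁ w)
    source-mass {L} conic w =
      trans (wsum-cong L (λ (s , _) → sym (netflowG-inject₁ s w))) (sym (netflow-superposition conic (inject₁ w)))

    Decomposition⇒Cayley : ∀ {x y} → SimplexFlow x y → Decomposition y → Cayley K (λ s q → UnitFlow (s , q)) x y
    Decomposition⇒Cayley {x} {y} flow (L , conic , y≡L) =
      ConvexHull-fromList {S = CayleyGenerator} (λ (s , q) → _++V_ K (basis K s) q) L
        (All.map (λ {(_ , s , q)} (0≤a , q∈) → 0≤a , s , q , q∈ , λ _ → refl) conic) total coordinates
      where
      open SimplexFlow flow
      open ≡.≡-Reasoning

      netflow-y : ∀ v → netflow G y v ≡ wsum (λ (s , _) → netflowG K s v) L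
      netflow-y v = trans (Linear.extensional (netflow-linear G v) y≡L) (netflow-superposition conic v)

      total : wsum (λ _ → 1F) L ≡ 1F
      total = begin
        wsum (λ _ → 1F) L                              ≡⟨ solve 1 (λ w → w := (:- (w :* (:- con (+ 1))))) refl _ ⟩
        -F (wsum (λ _ → 1F) L *F -F 1F)                ≡⟨ cong -F_ (wsum-const (-F 1F) L) ⟨
        -F wsum (λ _ → -F 1F) L                        ≡⟨ cong -F_ (wsum-cong L (λ (s , _) → netflowG-fromℕ s)) ⟨
        -F wsum (λ (s , _) → netflowG K s (fromℕ n)) L ≡⟨ cong -F_ (netflow-y (fromℕ n)) ⟨
        -F netflow G y (fromℕ n)                       ≡⟨ cong -F_ netflow-fromℕ ⟩
        -F -F 1F                                       ≡⟨ solve 0 ((:- (:- con (+ 1))) := con (+ 1)) refl ⟩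
        1F                                             ∎

      x≡ : ∀ i → x i ≡ wsum (λ (s , _) → basis K s i) L
      x≡ i = trans (sym (netflow-inject₁ i))
                   (trans (Linear.extensional (netflow-linear G (inject₁ i)) y≡L) (sym (source-mass conic i)))

      coordinates : ∀ c → _++V_ K x y c ≡ wsum (λ (s , q) → _++V_ K (basis K s) q c) L
      coordinates c = trans (++V-cong x≡ y≡L c) (sym (wsum-++V (basis K ∘ proj₁) proj₂ L c))

    Admissible : Vec K m → Set
    Admissible y = (∀ e → 0F ≤F y e) × (∀ i → 0F ≤F netflow G y (inject₁ i))

    erase : Fin m → Vec K m → Vec K m
    erase e y e′ = y e′ +F -F (y e *F basis K e e′)

    erase-self : ∀ e y → erase e y e ≡ 0F
    erase-self e y = trans (cong (λ δ → y e +F -F (y e *F δ)) (ifEq-refl e 1F))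
                           (solve 1 (λ a → (a :- (a :* con (+ 1))) := con (+ 0)) refl (y e))

    erase-≢ : ∀ {e e′} y → e ≢ e′ → erase e y e′ ≡ y e′
    erase-≢ {e} {e′} y e≢e′ = trans (cong (λ δ → y e′ +F -F (y e *F δ)) (ifEq-≢ e e′ 1F e≢e′))
                                    (solve 2 (λ a b → (a :- (b :* con (+ 0))) := a) refl (y e′) (y e))

    erase-vanishes : ∀ e y {e′} → y e′ ≡ 0F → erase e y e′ ≡ 0F
    erase-vanishes e y {e′} y≡0 with toSum (e ≟ e′)
    ... | inj₁ refl = erase-self e y
    ... | inj₂ e≢e′ = trans (erase-≢ y e≢e′) y≡0

    erase-nonneg : ∀ e {y} → (∀ e′ → 0F ≤F y e′) → ∀ e′ → 0F ≤F erase e y e′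
    erase-nonneg e {y} 0≤y e′ with toSum (e ≟ e′)
    ... | inj₁ refl = subst (0F ≤F_) (sym (erase-self e y)) ≤-refl
    ... | inj₂ e≢e′ = subst (0F ≤F_) (sym (erase-≢ y e≢e′)) (0≤y e′)

    erase+basis : ∀ e y e′ → y e′ ≡ erase e y e′ +F y e *F basis K e e′
    erase+basis e y e′ = solve 3 (λ a b δ → a := ((a :- (b :* δ)) :+ (b :* δ))) refl (y e′) (y e) (basis K e e′)

    netflow-erase : ∀ e y v → netflow G (erase e y) v ≡
                              netflow G y v +F -F (y e *F (ifEq K (tail e) v 1F +F -F ifEq K (head e) v 1F))
    netflow-erase e y v = begin
      netflow G (erase e y) v
        ≡⟨ extensional (λ e′ → solve 3 (λ a b δ → (a :- (b :* δ)) := (a :+ ((:- b) :* δ))) refl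
                                       (y e′) (y e) (basis K e e′)) ⟩
      netflow G (λ e′ → y e′ +F (-F y e) *F basis K e e′) v
        ≡⟨ additive y (λ e′ → (-F y e) *F basis K e e′) ⟩
      netflow G y v +F netflow G (λ e′ → (-F y e) *F basis K e e′) v
        ≡⟨ cong (netflow G y v +F_) (trans (homogeneous (-F y e) (basis K e)) (cong ((-F y e) *F_) (netflow-basis G e v))) ⟩
      netflow G y v +F (-F y e) *F (ifEq K (tail e) v 1F +F -F ifEq K (head e) v 1F)
        ≡⟨ solve 3 (λ a b d → (a :+ ((:- b) :* d)) := (a :- (b :* d))) refl _ _ _ ⟩
      netflow G y v +F -F (y e *F (ifEq K (tail e) v 1F +F -F ifEq K (head e) v 1F)) ∎
      where
      open ≡.≡-Reasoning
      open Linear (netflow-linear G v)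

    netflow-erase-≢tail : ∀ e y {v} → tail e ≢ v → netflow G (erase e y) v ≡ netflow G y v +F y e *F ifEq K (head e) v 1F
    netflow-erase-≢tail e y {v} tail≢v =
      trans (netflow-erase e y v)
            (trans (cong (λ t → netflow G y v +F -F (y e *F (t +F -F ifEq K (head e) v 1F))) (ifEq-≢ (tail e) v 1F tail≢v))
                   (solve 3 (λ a b h → (a :- (b :* (con (+ 0) :- h))) := (a :+ (b :* h))) refl _ _ _))

    module _ (inc : Increasing K G) where

      tail≢head : ∀ e → tail e ≢ head e
      tail≢head e tail≡head = ℕ.<-irrefl (cong toℕ tail≡head) (inc e)

      tail-inject₁ : ∀ e → ∃ λ u → tail e ≡ inject₁ u
      tail-inject₁ e = lower₁ (tail e) n≢tail , sym (inject₁-lower₁ (tail e) n≢tail)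
        where
        n≢tail : n ≢ toℕ (tail e)
        n≢tail n≡tail =
          ℕ.<-irrefl refl (ℕ.<-≤-trans (inc e) (subst (toℕ (head e) ℕ.≤_) n≡tail (toℕ≤pred[n] (head e))))

      erase-admissible : ∀ e {y} → Admissible y → (∀ e′ → head e′ ≡ tail e → y e′ ≡ 0F) → Admissible (erase e y)
      erase-admissible e {y} (0≤y , 0≤netflow) into-tail-vanishes = erase-nonneg e 0≤y , λ i → at (inject₁ i) (0≤netflow i)
        where
        at : ∀ v → 0F ≤F netflow G y v → 0F ≤F netflow G (erase e y) v
        at v 0≤netflow-v with toSum (tail e ≟ v)
        ... | inj₁ refl = netflow-nonneg-without-inflow G (tail e) (erase-nonneg e 0≤y)
                            (λ e′ head≡tail → erase-vanishes e y (into-tail-vanishes e′ head≡tail))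
        ... | inj₂ tail≢v = subst (0F ≤F_) (sym (netflow-erase-≢tail e y tail≢v))
                              (+-nonneg 0≤netflow-v (*-nonneg (0≤y e) (ifEq-nonneg (head e) v 0≤1)))

      edge-to-sink : ∀ {e u} → tail e ≡ inject₁ u → head e ≡ fromℕ n → UnitFlow (u , basis K e)
      edge-to-sink {e} {u} tail≡u head≡sink = (λ e′ → ifEq-nonneg e e′ 0≤1) , conservation
        where
        open ≡.≡-Reasoning
        conservation : ∀ v → netflow G (basis K e) v ≡ netflowG K u v
        conservation v = begin
          netflow G (basis K e) v
            ≡⟨ netflow-basis G e v ⟩
          ifEq K (tail e) v 1F +F -F ifEq K (head e) v 1F
            ≡⟨ cong₂ (λ t h → ifEq K t v 1F +F -F ifEq K h v 1F) tail≡u head≡sink ⟩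
          ifEq K (inject₁ u) v 1F +F -F ifEq K (fromℕ n) v 1F
            ≡⟨ cong (ifEq K (inject₁ u) v 1F +F_) (ifEq-map (fromℕ n) v -F_ (solve 0 ((:- con (+ 0)) := con (+ 0)) refl) 1F) ⟨
          netflowG K u v ∎

      extend-by-edge : ∀ {e u s q} → tail e ≡ inject₁ u → head e ≡ inject₁ s → UnitFlow (s , q) →
                       UnitFlow (u , λ e′ → q e′ +F basis K e e′)
      extend-by-edge {e} {u} {s} {q} tail≡u head≡s (0≤q , q-conservation) =
        (λ e′ → +-nonneg (0≤q e′) (ifEq-nonneg e e′ 0≤1)) , conservation
        where
        open ≡.≡-Reasoning
        conservation : ∀ v → netflow G (λ e′ → q e′ +F basis K e e′) v ≡ netflowG K u v
        conservation v = begin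
          netflow G (λ e′ → q e′ +F basis K e e′) v
            ≡⟨ additive q (basis K e) ⟩
          netflow G q v +F netflow G (basis K e) v
            ≡⟨ cong₂ _+F_ (q-conservation v) (netflow-basis G e v) ⟩
          netflowG K s v +F (ifEq K (tail e) v 1F +F -F ifEq K (head e) v 1F)
            ≡⟨ cong₂ (λ t h → netflowG K s v +F (ifEq K t v 1F +F -F ifEq K h v 1F)) tail≡u head≡s ⟩
          (ifEq K (inject₁ s) v 1F +F ifEq K (fromℕ n) v (-F 1F)) +F (ifEq K (inject₁ u) v 1F +F -F ifEq K (inject₁ s) v 1F)
            ≡⟨ solve 3 (λ a b c → ((a :+ b) :+ (c :- a)) := (c :+ b)) refl _ _ _ ⟩
          netflowG K u v ∎
          where open Linear (netflow-linear G v)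

      netflow-erase-head : ∀ e y → netflow G (erase e y) (head e) ≡ netflow G y (head e) +F y e
      netflow-erase-head e y = begin
        netflow G (erase e y) (head e)
          ≡⟨ netflow-erase e y (head e) ⟩
        netflow G y (head e) +F -F (y e *F (ifEq K (tail e) (head e) 1F +F -F ifEq K (head e) (head e) 1F))
          ≡⟨ cong₂ (λ t h → netflow G y (head e) +F -F (y e *F (t +F -F h)))
                   (ifEq-≢ (tail e) (head e) 1F (tail≢head e)) (ifEq-refl (head e) 1F) ⟩
        netflow G y (head e) +F -F (y e *F (0F +F -F 1F))
          ≡⟨ solve 2 (λ a c → (a :- (c :* (con (+ 0) :- con (+ 1)))) := (a :+ c)) refl _ _ ⟩
        netflow G y (head e) +F y e ∎
        where open ≡.≡-Reasoning

      reattach-at-sink : ∀ e {u y} → tail e ≡ inject₁ u → head e ≡ fromℕ n → (∀ e′ → 0F ≤F y e′) →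
                         Decomposition (erase e y) → Decomposition y
      reattach-at-sink e {u} {y} tail≡u head≡sink 0≤y (L , conic , erase≡L) =
        (y e , u , basis K e) ∷ L , (0≤y e , edge-to-sink tail≡u head≡sink) ∷ conic ,
        λ e′ → trans (erase+basis e y e′) (trans (cong (_+F y e *F basis K e e′) (erase≡L e′)) (+-comm _ _))

      -- The unit flows from w in the decomposition of erase e y carry weight netflow y w + y e,
      -- so weight y e of them can be prolonged backwards along e.
      reattach-through : ∀ e {u w y} → tail e ≡ inject₁ u → head e ≡ inject₁ w → Admissible y →
                         Decomposition (erase e y) → Decomposition y
      reattach-through e {u} {w} {y} tail≡u head≡w (0≤y , 0≤netflow) (L , conic , erase≡L) =
        map (map₂ extend) taken ++ rest ,
        ++⁺ (map⁺ (All.map extended taken-conic)) rest-conic ,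
        y≡
        where
        open ≡.≡-Reasoning

        extend : Fin n × Vec K m → Fin n × Vec K m
        extend (_ , q) = u , λ e′ → q e′ +F basis K e e′

        extended : ∀ {(a , s , q) : Carrier × (Fin n × Vec K m)} → 0F ≤F a × (UnitFlow (s , q) × s ≡ w) →
                   0F ≤F a × UnitFlow (extend (s , q))
        extended (0≤a , q∈ , s≡w) = 0≤a , extend-by-edge tail≡u (trans head≡w (cong inject₁ (sym s≡w))) q∈

        mass≡ : wsum (λ z → basis K (proj₁ z) w) L ≡ netflow G y (inject₁ w) +F y e
        mass≡ = begin
          wsum (λ z → basis K (proj₁ z) w) L           ≡⟨ source-mass conic w ⟩
          netflow G (superposition L) (inject₁ w)      ≡⟨ Linear.extensional (netflow-linear G (inject₁ w)) erase≡L ⟨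
          netflow G (erase e y) (inject₁ w)            ≡⟨ cong (netflow G (erase e y)) head≡w ⟨
          netflow G (erase e y) (head e)               ≡⟨ netflow-erase-head e y ⟩
          netflow G y (head e) +F y e                  ≡⟨ cong (λ v → netflow G y v +F y e) head≡w ⟩
          netflow G y (inject₁ w) +F y e               ∎

        open Split (split proj₁ w L conic (0≤y e) (subst (y e ≤F_) (sym mass≡) (x≤y+x (0≤netflow w))))

        y≡ : ∀ e′ → y e′ ≡ superposition (map (map₂ extend) taken ++ rest) e′
        y≡ e′ = begin
          y e′
            ≡⟨ erase+basis e y e′ ⟩
          erase e y e′ +F y e *F basis K e e′
            ≡⟨ cong₂ (λ a c → a +F c *F basis K e e′)
                     (trans (erase≡L e′) (sym (partition (λ (_ , q) → q e′)))) (sym taken-weight) ⟩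
          (superposition taken e′ +F superposition rest e′) +F wsum (λ _ → 1F) taken *F basis K e e′
            ≡⟨ solve 4 (λ a b c δ → ((a :+ b) :+ (c :* δ)) := ((a :+ (c :* δ)) :+ b)) refl _ _ _ _ ⟩
          (superposition taken e′ +F wsum (λ _ → 1F) taken *F basis K e e′) +F superposition rest e′
            ≡⟨ cong (λ c → (superposition taken e′ +F c) +F superposition rest e′) (wsum-const (basis K e e′) taken) ⟨
          (superposition taken e′ +F wsum (λ _ → basis K e e′) taken) +F superposition rest e′
            ≡⟨ cong (_+F superposition rest e′) (wsum-+ (λ (_ , q) → q e′) (λ _ → basis K e e′) taken) ⟨
          wsum (λ (_ , q) → q e′ +F basis K e e′) taken +F superposition rest e′
            ≡⟨ cong (_+F superposition rest e′) (wsum-map₂ (λ (_ , q) → q e′) extend taken) ⟨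
          superposition (map (map₂ extend) taken) e′ +F superposition rest e′
            ≡⟨ wsum-++ (λ (_ , q) → q e′) (map (map₂ extend) taken) rest ⟨
          superposition (map (map₂ extend) taken ++ rest) e′ ∎

      reattach : ∀ e {y} → Admissible y → Decomposition (erase e y) → Decomposition y
      reattach e admissible with tail-inject₁ e | fromℕ-or-inject₁ (head e)
      ... | _ , tail≡u | inj₁ head≡sink = reattach-at-sink e tail≡u head≡sink (proj₁ admissible)
      ... | _ , tail≡u | inj₂ (_ , head≡w) = reattach-through e tail≡u head≡w admissible

      VanishesBelow : ℕ → Vec K m → Set
      VanishesBelow t y = ∀ e → toℕ (tail e) ℕ.< t → y e ≡ 0F

      -- While the edges out of t are erased one at a time, every edge into t already vanishes,
      -- so the netflow at t stays an outflow and hence nonnegative.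
      peel-out-edges : ∀ t → (∀ y → Admissible y → VanishesBelow (suc t) y → Decomposition y) →
                       ∀ y → Admissible y → VanishesBelow t y → Decomposition y
      peel-out-edges t decompose-above y admissible below =
        peel (allFin m) y admissible below (λ e _ e∉ → ⊥-elim (e∉ (∈-allFin e)))
        where
        peel : ∀ es y → Admissible y → VanishesBelow t y → (∀ e → toℕ (tail e) ≡ t → e ∉ es → y e ≡ 0F) →
               Decomposition y
        peel [] y admissible below outside =
          decompose-above y admissible λ e tail<1+t →
            [ below e , (λ tail≡t → outside e tail≡t λ ()) ]′ (ℕ.m<1+n⇒m<n∨m≡n tail<1+t)
        peel (e ∷ es) y admissible below outside with toℕ (tail e) ℕ.≟ t
        ... | no tail≢t = peel es y admissible below λ e′ tail≡t e′∉es →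
              outside e′ tail≡t λ { (here refl) → tail≢t tail≡t ; (there e′∈es) → e′∉es e′∈es }
        ... | yes tail≡t = reattach e admissible
              (peel es (erase e y) (erase-admissible e admissible into-tail-vanishes)
                    (λ e′ tail<t → erase-vanishes e y (below e′ tail<t)) outside′)
          where
          into-tail-vanishes : ∀ e′ → head e′ ≡ tail e → y e′ ≡ 0F
          into-tail-vanishes e′ head≡tail =
            below e′ (subst (toℕ (tail e′) ℕ.<_) (trans (cong toℕ head≡tail) tail≡t) (inc e′))
          outside′ : ∀ e′ → toℕ (tail e′) ≡ t → e′ ∉ es → erase e y e′ ≡ 0F
          outside′ e′ tail≡t e′∉es with toSum (e ≟ e′)
          ... | inj₁ refl = erase-self e y
          ... | inj₂ e≢e′ = trans (erase-≢ y e≢e′)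
                (outside e′ tail≡t λ { (here e′≡e) → e≢e′ (sym e′≡e) ; (there e′∈es) → e′∉es e′∈es })

      decompose-below : ∀ d t → d ℕ.+ t ≡ suc n → ∀ y → Admissible y → VanishesBelow t y → Decomposition y
      decompose-below zero t refl y _ below = [] , [] , λ e → below e (toℕ<n (tail e))
      decompose-below (suc d) t d+t≡ = peel-out-edges t (decompose-below d (suc t) (trans (ℕ.+-suc d t) d+t≡))

      decompose : ∀ y → Admissible y → Decomposition y
      decompose y admissible = decompose-below (suc n) 0 (ℕ.+-identityʳ (suc n)) y admissible (λ _ ())

      SimplexFlow⇒Cayley : ∀ {x y} → SimplexFlow x y → Cayley K (λ s q → UnitFlow (s , q)) x y
      SimplexFlow⇒Cayley {y = y} flow =
        Decomposition⇒Cayley flow (decompose y (flow-nonneg , λ i → subst (0F ≤F_) (sym (netflow-inject₁ i)) (supply-nonneg i)))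
        where open SimplexFlow flow

proposition7p2 : (K : OrderedField) (n m : ℕ) (G : Edges K (suc n) m) →
    Increasing K G →
    (x : Vec K n) (y : Vec K m) →
    Cayley K (λ i → FlowPolytope K G (netflowG K i)) x y
      ⇔ FlowPolytope K (star K G) (netflowStar K) (_++V_ K x y)
proposition7p2 K n m G inc x y =
  mk⇔ (Cayley⇒StarFlow K G) (SimplexFlow⇒Cayley K G inc ∘ StarFlow⇒SimplexFlow K G)
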